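{- Let $q$ be a prime power and $r,m$ positive integers. For an integer $d$ write $w=\lfloor d/q\rfloor$ and define $$\Gamma_1(q,r,m,d)=\frac{\binom{m+r-1}{m}q^m+(d-qw)\binom{m+r-w-2}{m-1}q^{m-1}-\binom{m+r-w-1}{m}q^m}{\binom{m+r-1}{r-1}},\qquad \Gamma_2(q,r,m,d)=\frac{dq^{m-1}}{r}.$$ Then $\Gamma_1(q,r,m,d)\ge\Gamma_2(q,r,m,d)$ for all integers $d$ with $0\le d\le rq-1$. -}

module Defs where

open import Data.Nat using (ℕ; zero; suc; _+_; _*_; _∸_; _^_; _≤_; _<_; z≤n; s≤s; NonZero; >-nonZero)
open import Data.Nat.Properties using (m≤n⇒m<n∨m≡n)
import Data.Nat.Properties
open import Data.Nat.DivMod using (_/_)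
open import Data.Nat.Primality using (Prime)
open import Data.Nat.Combinatorics using (_C_; nCn≡1; nCk+nC[k+1]≡[n+1]C[k+1])
open import Data.Integer as ℤ using (ℤ; +_)
open import Data.Rational as ℚ using (ℚ)
open import Data.Product using (Σ; _×_; ∃; ∃-syntax)
open import Data.Sum using (inj₁; inj₂)
open import Relation.Binary.PropositionalEquality using (_≡_; refl; sym; subst; cong)

IsPrimePower : ℕ → Set
IsPrimePower q = ∃[ p ] ∃[ k ] (Prime p × 1 ≤ k × q ≡ p ^ k)

C-pos : ∀ n k → k ≤ n → 0 < n C k
C-pos n zero _ = s≤s z≤n
C-pos zero (suc k) ()
C-pos (suc n) (suc k) (s≤s k≤n) with m≤n⇒m<n∨m≡n k≤n
... | inj₂ refl = subst (0 <_) (sym (nCn≡1 (suc n))) (s≤s z≤n)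
... | inj₁ k<n =
  subst (0 <_) (nCk+nC[k+1]≡[n+1]C[k+1] n k)
        (Data.Nat.Properties.≤-trans (C-pos n (suc k) k<n) (Data.Nat.Properties.m≤n+m (n C suc k) (n C k)))

denom-nonZero : ∀ r m → NonZero ((m + r ∸ 1) C (r ∸ 1))
denom-nonZero r m = >-nonZero (C-pos (m + r ∸ 1) (r ∸ 1) (le r m))
  where
  le : ∀ r m → r ∸ 1 ≤ m + r ∸ 1
  le zero m = z≤n
  le (suc r) m = subst (r ≤_) (sym (cong (_∸ 1) (Data.Nat.Properties.+-suc m r))) (Data.Nat.Properties.m≤n+m r m)

-- Γ₁(q,r,m,d) with w = ⌊d/q⌋ (d a natural number, since 0 ≤ d in the theorem)
Γ₁ : (q r m d : ℕ) → .{{_ : NonZero q}} → ℚ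
Γ₁ q r m d = ℚ._/_ numer ((m + r ∸ 1) C (r ∸ 1)) {{denom-nonZero r m}}
  where
  w : ℕ
  w = d / q
  numer : ℤ
  numer = (+ (((m + r ∸ 1) C m) * q ^ m))
          ℤ.+ ((+ d ℤ.- + (q * w)) ℤ.* + (((m + r ∸ w ∸ 2) C (m ∸ 1)) * q ^ (m ∸ 1)))
          ℤ.- + (((m + r ∸ w ∸ 1) C m) * q ^ m)

Γ₂ : (q r m d : ℕ) → .{{_ : NonZero r}} → ℚ
Γ₂ q r m d = ℚ._/_ (+ (d * q ^ (m ∸ 1))) r

-- Write d = q w + s with 0 ≤ s < q and r = w + 1 + u, and let N = C(m+r-1, m).
-- Clearing denominators and dividing by q^(m-1), Γ₂ ≤ Γ₁ becomes
--   d N + r q C(m+u, m) ≤ r (q N + s C(m+u-1, m-1)).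
-- Splitting C(m+u, m) = C(m+u-1, m-1) + C(m+u-1, m) by Pascal's rule, this follows from
-- r C(m+u, m) ≤ (u+1) N and r C(m+u-1, m) ≤ u N, both instances of the fact that
-- C(m-1+k, m)/k = C(m-1+k, m-1)/m increases with k.
module Submission where

open import Data.Integer as ℤ using (+_; +≤+)
import Data.Integer.Properties as ℤ
import Data.Integer.Tactic.RingSolver as ℤ-Solver
open import Data.Nat as ℕ using (ℕ; zero; suc; NonZero; _+_; _*_; _∸_; _^_; _≤_; s≤s; s≤s⁻¹; _≤′_; ≤′-refl; ≤′-step)
open import Data.Nat.Combinatorics using (_C_; nC1≡n; nCk≡nC[n∸k]; k>n⇒nCk≡0; nCk+nC[k+1]≡[n+1]C[k+1])
open import Data.Nat.DivMod using (_/_; _%_; m≡m%n+[m/n]*n; m%n<n; m<n*o⇒m/o<n)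
open import Data.Nat.Properties
open import Data.Nat.Tactic.RingSolver using (solve-∀)
open import Data.Rational as ℚ using () renaming (_≤_ to _≤ℚ_)
open import Data.Rational.Properties using (toℚᵘ-cancel-≤; toℚᵘ-fromℚᵘ)
import Data.Rational.Unnormalised as ℚᵘ
import Data.Rational.Unnormalised.Properties as ℚᵘ
open import Relation.Binary.PropositionalEquality
open import Algebra.Properties.CommutativeSemigroup *-commutativeSemigroup using (x∙yz≈y∙xz)

open import Defs

absorption : ∀ n k → suc k * (suc n C suc k) ≡ suc n * (n C k)
absorption zero    zero    = refl
absorption zero    (suc k) = begin
  suc (suc k) * (1 C suc (suc k)) ≡⟨ cong (suc (suc k) *_) (k>n⇒nCk≡0 {1} {suc (suc k)} (s≤s (s≤s ℕ.z≤n))) ⟩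
  suc (suc k) * 0                 ≡⟨ *-zeroʳ (suc (suc k)) ⟩
  0                               ≡⟨ k>n⇒nCk≡0 {0} {suc k} (s≤s ℕ.z≤n) ⟨
  1 * (0 C suc k)                 ∎
  where open ≡-Reasoning
absorption (suc n) zero    = trans (+-identityʳ _) (trans (nC1≡n (suc (suc n))) (sym (*-identityʳ _)))
absorption (suc n) (suc k) = begin
  suc (suc k) * (suc (suc n) C suc (suc k))
    ≡⟨ cong (suc (suc k) *_) (nCk+nC[k+1]≡[n+1]C[k+1] (suc n) (suc k)) ⟨
  suc (suc k) * (a + b)
    ≡⟨ regroup (suc k) a b ⟩
  (suc k * a + suc (suc k) * b) + a
    ≡⟨ cong (_+ a) (cong₂ _+_ (absorption n k) (absorption n (suc k))) ⟩
  (suc n * (n C k) + suc n * (n C suc k)) + a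
    ≡⟨ cong (_+ a) (trans (sym (*-distribˡ-+ (suc n) (n C k) (n C suc k))) (cong (suc n *_) (nCk+nC[k+1]≡[n+1]C[k+1] n k))) ⟩
  suc n * a + a
    ≡⟨ +-comm (suc n * a) a ⟩
  suc (suc n) * a ∎
  where
  open ≡-Reasoning
  a = suc n C suc k
  b = suc n C suc (suc k)
  regroup : ∀ x a b → suc x * (a + b) ≡ (x * a + suc x * b) + a
  regroup = solve-∀

C-sym : ∀ a b → (a + b) C a ≡ (a + b) C b
C-sym a b = trans (nCk≡nC[n∸k] (m≤m+n a b)) (cong ((a + b) C_) (m+n∸m≡n a b))

[1+a]*C[a+k,1+a]≡k*C[a+k,a] : ∀ a k → suc a * ((a + k) C suc a) ≡ k * ((a + k) C a)
[1+a]*C[a+k,1+a]≡k*C[a+k,a] a zero = begin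
  suc a * ((a + 0) C suc a) ≡⟨ cong (λ n → suc a * (n C suc a)) (+-identityʳ a) ⟩
  suc a * (a C suc a)       ≡⟨ cong (suc a *_) (k>n⇒nCk≡0 (n<1+n a)) ⟩
  suc a * 0                 ≡⟨ *-zeroʳ (suc a) ⟩
  0                         ∎
  where open ≡-Reasoning
[1+a]*C[a+k,1+a]≡k*C[a+k,a] a (suc k) = begin
  suc a * ((a + suc k) C suc a)  ≡⟨ cong (λ n → suc a * (n C suc a)) (+-suc a k) ⟩
  suc a * (suc (a + k) C suc a)  ≡⟨ absorption (a + k) a ⟩
  suc (a + k) * ((a + k) C a)    ≡⟨ cong (suc (a + k) *_) (C-sym a k) ⟩
  suc (a + k) * ((a + k) C k)    ≡⟨ absorption (a + k) k ⟨
  suc k * (suc (a + k) C suc k)  ≡⟨ cong (λ n → suc k * (n C suc k)) (+-suc a k) ⟨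
  suc k * ((a + suc k) C suc k)  ≡⟨ cong (suc k *_) (C-sym a (suc k)) ⟨
  suc k * ((a + suc k) C a)      ∎
  where open ≡-Reasoning

nCk≤[1+n]Ck : ∀ n k → n C k ≤ suc n C k
nCk≤[1+n]Ck n zero    = ≤-refl
nCk≤[1+n]Ck n (suc k) = subst (n C suc k ≤_) (nCk+nC[k+1]≡[n+1]C[k+1] n k) (m≤n+m _ _)

C-monoˡ-≤ : ∀ k {m n} → m ≤ n → m C k ≤ n C k
C-monoˡ-≤ k m≤n = go (≤⇒≤′ m≤n)
  where
  go : ∀ {m n} → m ≤′ n → m C k ≤ n C k
  go ≤′-refl       = ≤-refl
  go (≤′-step m≤n) = ≤-trans (go m≤n) (nCk≤[1+n]Ck _ k)

l*C[a+k,1+a]≤k*C[a+l,1+a] : ∀ a {k l} → k ≤ l → l * ((a + k) C suc a) ≤ k * ((a + l) C suc a)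
l*C[a+k,1+a]≤k*C[a+l,1+a] a {k} {l} k≤l = *-cancelˡ-≤ (suc a) (begin
  suc a * (l * ((a + k) C suc a)) ≡⟨ x∙yz≈y∙xz (suc a) l _ ⟩
  l * (suc a * ((a + k) C suc a)) ≡⟨ cong (l *_) ([1+a]*C[a+k,1+a]≡k*C[a+k,a] a k) ⟩
  l * (k * ((a + k) C a))         ≡⟨ x∙yz≈y∙xz l k _ ⟩
  k * (l * ((a + k) C a))         ≤⟨ *-monoʳ-≤ k (*-monoʳ-≤ l (C-monoˡ-≤ a (+-monoʳ-≤ a k≤l))) ⟩
  k * (l * ((a + l) C a))         ≡⟨ cong (k *_) ([1+a]*C[a+k,1+a]≡k*C[a+k,a] a l) ⟨
  k * (suc a * ((a + l) C suc a)) ≡⟨ x∙yz≈y∙xz k (suc a) _ ⟩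
  suc a * (k * ((a + l) C suc a)) ∎)
  where open ≤-Reasoning

C[a+1+b,b]≡C[a+1+b,1+a] : ∀ a b → (a + suc b) C b ≡ (a + suc b) C suc a
C[a+1+b,b]≡C[a+1+b,1+a] a b = begin
  (a + suc b) C b     ≡⟨ cong (_C b) (+-suc a b) ⟩
  (suc a + b) C b     ≡⟨ C-sym (suc a) b ⟨
  (suc a + b) C suc a ≡⟨ cong (_C suc a) (+-suc a b) ⟨
  (a + suc b) C suc a ∎
  where open ≡-Reasoning

[1+a]+[1+w+b]∸w≡2+a+b : ∀ a w b → suc a + suc (w + b) ∸ w ≡ suc (suc (a + b))
[1+a]+[1+w+b]∸w≡2+a+b a w b = trans (cong (_∸ w) (move-w a w b)) (m+n∸m≡n w _)
  where
  move-w : ∀ a w b → suc a + suc (w + b) ≡ w + suc (suc (a + b))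
  move-w = solve-∀

cleared-inequality : ∀ N A B₁ s t w u →
  suc (w + u) * (A + B₁) ≤ suc u * N → suc (w + u) * B₁ ≤ u * N →
  (s + (s + t) * w) * N + suc (w + u) * ((s + t) * (A + B₁)) ≤ suc (w + u) * ((s + t) * N + s * A)
cleared-inequality N A B₁ s t w u rB≤[1+u]N rB₁≤uN = begin
  (s + (s + t) * w) * N + r * ((s + t) * (A + B₁))
    ≡⟨ expand N A B₁ s t w u ⟩
  ((s + (s + t) * w) * N + r * s * A) + s * (r * B₁) + t * (r * (A + B₁))
    ≤⟨ +-mono-≤ (+-monoʳ-≤ _ (*-monoʳ-≤ s rB₁≤uN)) (*-monoʳ-≤ t rB≤[1+u]N) ⟩
  ((s + (s + t) * w) * N + r * s * A) + s * (u * N) + t * (suc u * N)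
    ≡⟨ collect N A s t w u ⟩
  r * ((s + t) * N + s * A) ∎
  where
  open ≤-Reasoning
  r = suc (w + u)
  expand : ∀ N A B₁ s t w u →
    (s + (s + t) * w) * N + suc (w + u) * ((s + t) * (A + B₁))
      ≡ ((s + (s + t) * w) * N + suc (w + u) * s * A) + s * (suc (w + u) * B₁) + t * (suc (w + u) * (A + B₁))
  expand = solve-∀
  collect : ∀ N A s t w u →
    ((s + (s + t) * w) * N + suc (w + u) * s * A) + s * (u * N) + t * (suc u * N)
      ≡ suc (w + u) * ((s + t) * N + s * A)
  collect = solve-∀

Γ₂≤Γ₁-cleared : ∀ m₀ {q r₀ d} w s u t → r₀ ≡ w + u → q ≡ s + t → d ≡ s + q * w →
  (d * q ^ m₀) * ((m₀ + suc r₀) C r₀) + (((suc m₀ + suc r₀ ∸ w ∸ 1) C suc m₀) * q ^ suc m₀) * suc r₀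
    ≤ (((m₀ + suc r₀) C suc m₀) * q ^ suc m₀ + s * (((suc m₀ + suc r₀ ∸ w ∸ 2) C m₀) * q ^ m₀)) * suc r₀
Γ₂≤Γ₁-cleared m₀ w s u t refl refl refl
  rewrite C[a+1+b,b]≡C[a+1+b,1+a] m₀ (w + u) | [1+a]+[1+w+b]∸w≡2+a+b m₀ w u
        | sym (nCk+nC[k+1]≡[n+1]C[k+1] (m₀ + u) m₀) =
  subst₂ _≤_ (scale-lhs N A B₁ s t w u P) (scale-rhs N A s t w u P)
    (*-monoʳ-≤ P (cleared-inequality N A B₁ s t w u rB≤[1+u]N rB₁≤uN))
  where
  N  = (m₀ + suc (w + u)) C suc m₀
  A  = (m₀ + u) C m₀
  B₁ = (m₀ + u) C suc m₀
  P  = (s + t) ^ m₀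
  rB≤[1+u]N : suc (w + u) * (A + B₁) ≤ suc u * N
  rB≤[1+u]N = subst (λ B → suc (w + u) * B ≤ suc u * N)
    (trans (cong (_C suc m₀) (+-suc m₀ u)) (sym (nCk+nC[k+1]≡[n+1]C[k+1] (m₀ + u) m₀)))
    (l*C[a+k,1+a]≤k*C[a+l,1+a] m₀ (s≤s (m≤n+m u w)))
  rB₁≤uN : suc (w + u) * B₁ ≤ u * N
  rB₁≤uN = l*C[a+k,1+a]≤k*C[a+l,1+a] m₀ (m≤n⇒m≤1+n (m≤n+m u w))
  scale-lhs : ∀ N A B₁ s t w u P →
    P * ((s + (s + t) * w) * N + suc (w + u) * ((s + t) * (A + B₁)))
      ≡ ((s + (s + t) * w) * P) * N + ((A + B₁) * ((s + t) * P)) * suc (w + u)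
  scale-lhs = solve-∀
  scale-rhs : ∀ N A s t w u P →
    P * (suc (w + u) * ((s + t) * N + s * A)) ≡ (N * ((s + t) * P) + s * (A * P)) * suc (w + u)
  scale-rhs = solve-∀

m+o≤n⇒+m≤+n-+o : ∀ {m n o} → m + o ≤ n → + m ℤ.≤ + n ℤ.- + o
m+o≤n⇒+m≤+n-+o {m} {n} {o} m+o≤n = subst (+ m ℤ.≤_) +n-+o≡+[n∸o] (+≤+ (m+n≤o⇒m≤o∸n m m+o≤n))
  where
  +n-+o≡+[n∸o] : + (n ∸ o) ≡ + n ℤ.- + o
  +n-+o≡+[n∸o] = sym (trans (ℤ.[+m]-[+n]≡m⊖n n o) (ℤ.≤-⊖ (≤-trans (m≤n+m o m) m+o≤n)))

numerator-identity : ∀ {d} X Y Z r s a → d ≡ s + a →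
  (+ X ℤ.+ (+ d ℤ.- + a) ℤ.* + Y ℤ.- + Z) ℤ.* + r ≡ + ((X + s * Y) * r) ℤ.- + (Z * r)
numerator-identity X Y Z r s a refl = begin
  (+ X ℤ.+ (+ (s + a) ℤ.- + a) ℤ.* + Y ℤ.- + Z) ℤ.* + r
    ≡⟨ cong (λ d → (+ X ℤ.+ (d ℤ.- + a) ℤ.* + Y ℤ.- + Z) ℤ.* + r) (ℤ.pos-+ s a) ⟩
  (+ X ℤ.+ (+ s ℤ.+ + a ℤ.- + a) ℤ.* + Y ℤ.- + Z) ℤ.* + r
    ≡⟨ cancel (+ X) (+ s) (+ a) (+ Y) (+ Z) (+ r) ⟩
  (+ X ℤ.+ + s ℤ.* + Y) ℤ.* + r ℤ.- + Z ℤ.* + r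
    ≡⟨ cong₂ (λ b c → (+ X ℤ.+ b) ℤ.* + r ℤ.- c) (ℤ.pos-* s Y) (ℤ.pos-* Z r) ⟨
  (+ X ℤ.+ + (s * Y)) ℤ.* + r ℤ.- + (Z * r)
    ≡⟨ cong (λ b → b ℤ.* + r ℤ.- + (Z * r)) (ℤ.pos-+ X (s * Y)) ⟨
  + (X + s * Y) ℤ.* + r ℤ.- + (Z * r)
    ≡⟨ cong (ℤ._- + (Z * r)) (ℤ.pos-* (X + s * Y) r) ⟨
  + ((X + s * Y) * r) ℤ.- + (Z * r) ∎
  where
  open ≡-Reasoning
  cancel : ∀ x s a y z r → (x ℤ.+ (s ℤ.+ a ℤ.- a) ℤ.* y ℤ.- z) ℤ.* r ≡ (x ℤ.+ s ℤ.* y) ℤ.* r ℤ.- z ℤ.* r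
  cancel = ℤ-Solver.solve-∀

*≤*⇒/≤/ : ∀ {a c b d} .{{_ : NonZero b}} .{{_ : NonZero d}} →
          a ℤ.* + d ℤ.≤ c ℤ.* + b → a ℚ./ b ℚ.≤ c ℚ./ d
*≤*⇒/≤/ {a} {c} {suc b} {suc d} ad≤cb = toℚᵘ-cancel-≤
  (ℚᵘ.≤-respˡ-≃ (ℚᵘ.≃-sym (toℚᵘ-fromℚᵘ (ℚᵘ.mkℚᵘ a b)))
  (ℚᵘ.≤-respʳ-≃ (ℚᵘ.≃-sym (toℚᵘ-fromℚᵘ (ℚᵘ.mkℚᵘ c d))) (ℚᵘ.*≤* ad≤cb)))

proposition45 : (q : ℕ) → .{{_ : NonZero q}} → IsPrimePower q → (r m : ℕ) → .{{_ : NonZero r}} → .{{_ : NonZero m}} → (d : ℕ) → d ≤ r * q ∸ 1 → Γ₂ q r m d ≤ℚ Γ₁ q r m d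
proposition45 q@(suc _) _ (suc r₀) (suc m₀) d d≤rq∸1 =
  *≤*⇒/≤/ {a = + (d * q ^ m₀)} {c = numerator} {{_}} {{denom-nonZero (suc r₀) (suc m₀)}}
    (subst₂ ℤ._≤_ (ℤ.pos-* (d * q ^ m₀) N) (sym (numerator-identity X Y Z (suc r₀) s (q * w) d≡s+qw))
      (m+o≤n⇒+m≤+n-+o (Γ₂≤Γ₁-cleared m₀ w s u t r₀≡w+u q≡s+t d≡s+qw)))
  where
  w = d / q
  s = d % q
  u = r₀ ∸ w
  t = q ∸ s
  N = (m₀ + suc r₀) C r₀
  X = ((m₀ + suc r₀) C suc m₀) * q ^ suc m₀
  Y = ((suc m₀ + suc r₀ ∸ w ∸ 2) C m₀) * q ^ m₀
  Z = ((suc m₀ + suc r₀ ∸ w ∸ 1) C suc m₀) * q ^ suc m₀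
  numerator = + X ℤ.+ (+ d ℤ.- + (q * w)) ℤ.* + Y ℤ.- + Z
  d≡s+qw : d ≡ s + q * w
  d≡s+qw = trans (m≡m%n+[m/n]*n d q) (cong (_+_ s) (*-comm w q))
  r₀≡w+u : r₀ ≡ w + u
  r₀≡w+u = sym (m+[n∸m]≡n (s≤s⁻¹ (m<n*o⇒m/o<n (s≤s d≤rq∸1))))
  q≡s+t : q ≡ s + t
  q≡s+t = sym (m+[n∸m]≡n (<⇒≤ (m%n<n d q)))
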